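{- For every $n\ge 3$, the triangular book graph $B_n$ on $n$ vertices satisfies $\lambda(B_n)=n$.
   Context: The triangular book graph is $B_n=K_2\nabla\overline{K_{n-2}}$: two adjacent "spine" vertices, plus $n-2$ pairwise nonadjacent vertices each adjacent to both spine vertices. For a $k$-coloring $c:V(G)\to\{1,\dots,k\}$ the induced edge coloring is $c'(\{u,v\})=\{c(u),c(v)\}$ (a multiset); $c$ is edge-distinguishing if $c'$ is injective, and $\lambda(G)$ is the least $k$ admitting an edge-distinguishing $k$-coloring. -}

module Defs where

open import Data.Nat using (ℕ; _<_; _≤_)
open import Data.Fin using (Fin; toℕ)
open import Data.Product using (_×_; Σ)
open import Data.Sum using (_⊎_)
open import Relation.Binary.PropositionalEquality using (_≡_)
open import Relation.Nullary using (¬_)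

record Graph (n : ℕ) : Set₁ where
  field
    Adj     : Fin n → Fin n → Set
    sym     : ∀ {u v} → Adj u v → Adj v u
    irrefl  : ∀ {u} → ¬ Adj u u

open Graph public

-- Triangular book graph B_n = K_2 ∇ complement(K_{n-2}) on vertex set Fin n.
-- Spine vertices: those with index 0 and 1. u ~ v iff u ≠ v and at least one
-- of u, v is a spine vertex.
BookAdj : (n : ℕ) → Fin n → Fin n → Set
BookAdj n u v = ¬ (u ≡ v) × (toℕ u < 2 ⊎ toℕ v < 2)

book : (n : ℕ) → Graph n
book n = record
  { Adj = BookAdj n
  ; sym = λ { (ne , inj) → (λ e → ne (Eq.sym e)) , Sum.swap inj }
  ; irrefl = λ { (ne , _) → ne Eq.refl }
  }
  where
    import Relation.Binary.PropositionalEquality as Eq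
    import Data.Sum as Sum
    open import Data.Product using (_,_)

MSet2Eq : ∀ {A : Set} → A → A → A → A → Set
MSet2Eq a b c d = (a ≡ c × b ≡ d) ⊎ (a ≡ d × b ≡ c)

-- A k-coloring c : V → {1..k} (modelled as Fin k) is edge-distinguishing if
-- the induced edge coloring {u,v} ↦ {c u, c v} is injective on edges
-- (edges being unordered pairs {u,v} with u ~ v).
EdgeDistinguishing : ∀ {n k} → Graph n → (Fin n → Fin k) → Set
EdgeDistinguishing {n} G c =
  ∀ u v x y → Adj G u v → Adj G x y →
  MSet2Eq (c u) (c v) (c x) (c y) → MSet2Eq u v x y

HasEDColoring : ∀ {n} → Graph n → ℕ → Set
HasEDColoring {n} G k = Σ (Fin n → Fin k) (λ c → EdgeDistinguishing G c)

Lambda≡ : ∀ {n} → Graph n → ℕ → Set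
Lambda≡ G m = HasEDColoring G m × (∀ k → k < m → ¬ HasEDColoring G k)

{-# OPTIONS --safe #-}
module Submission where

-- Any two distinct vertices u, v of B_n (n ≥ 3) have a common neighbour w, so an
-- edge-distinguishing colouring c with c u = c v would give the edges wu and wv the
-- same colour; hence c is injective and needs at least n colours, while the identity
-- colouring uses exactly n.

open import Defs
open import Data.Nat using (ℕ; _≤_; _<_; s≤s; z<s; s<s)
open import Data.Nat.Properties using (<⇒≱)
open import Data.Fin using (Fin; toℕ) renaming (zero to fz; suc to fs)
open import Data.Fin.Properties using (injective⇒≤; _≟_)
open import Data.Product using (Σ; _×_; _,_)
open import Data.Sum using (inj₁; inj₂)
open import Data.Empty using (⊥-elim)
open import Function using (id)
open import Function.Definitions using (Injective)
open import Relation.Binary.PropositionalEquality using (_≡_; _≢_; refl; subst)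
open import Relation.Nullary using (yes; no)

CommonNeighbour : ∀ {n} → Graph n → Fin n → Fin n → Set
CommonNeighbour {n} G u v = Σ (Fin n) λ w → Adj G w u × Adj G w v

id-edgeDistinguishing : ∀ {n} (G : Graph n) → EdgeDistinguishing G id
id-edgeDistinguishing G u v x y _ _ same = same

edgeDistinguishing⇒injective : ∀ {n k} (G : Graph n) →
                               (∀ {u v} → u ≢ v → CommonNeighbour G u v) →
                               (c : Fin n → Fin k) → EdgeDistinguishing G c →
                               Injective _≡_ _≡_ c
edgeDistinguishing⇒injective G common c ed {u} {v} cu≡cv with u ≟ v
... | yes u≡v = u≡v
... | no u≢v with common u≢v
...   | w , wu , wv with ed w u w v wu wv (inj₁ (refl , cu≡cv))
...   | inj₁ (_ , u≡v) = u≡v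
...   | inj₂ (w≡v , _) = ⊥-elim (irrefl G (subst (λ x → Adj G x v) w≡v wv))

lambda≡order : ∀ {n} (G : Graph n) →
               (∀ {u v} → u ≢ v → CommonNeighbour G u v) → Lambda≡ G n
lambda≡order G common =
    (id , id-edgeDistinguishing G)
  , λ k k<n (c , ed) →
      <⇒≱ k<n (injective⇒≤ (edgeDistinguishing⇒injective G common c ed))

spine-adjˡ : ∀ {n} {w u : Fin n} → toℕ w < 2 → w ≢ u → BookAdj n w u
spine-adjˡ w<2 w≢u = w≢u , inj₁ w<2

spine-adjʳ : ∀ {n} {w u : Fin n} → toℕ u < 2 → w ≢ u → BookAdj n w u
spine-adjʳ u<2 w≢u = w≢u , inj₂ u<2

-- The two spine vertices meet at the page 2; any other pair avoids a spine vertex.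
book-commonNeighbour : ∀ {n} → 3 ≤ n → ∀ {u v : Fin n} → u ≢ v →
                       CommonNeighbour (book n) u v
book-commonNeighbour (s≤s (s≤s (s≤s _))) {u} {v} u≢v with u | v
... | fz        | fz        = ⊥-elim (u≢v refl)
... | fs fz     | fs fz     = ⊥-elim (u≢v refl)
... | fz        | fs fz     = fs (fs fz) , spine-adjʳ z<s (λ ()) , spine-adjʳ (s<s z<s) (λ ())
... | fs fz     | fz        = fs (fs fz) , spine-adjʳ (s<s z<s) (λ ()) , spine-adjʳ z<s (λ ())
... | fz        | fs (fs _) = fs fz , spine-adjˡ (s<s z<s) (λ ()) , spine-adjˡ (s<s z<s) (λ ())
... | fs (fs _) | fz        = fs fz , spine-adjˡ (s<s z<s) (λ ()) , spine-adjˡ (s<s z<s) (λ ())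
... | fs fz     | fs (fs _) = fz , spine-adjˡ z<s (λ ()) , spine-adjˡ z<s (λ ())
... | fs (fs _) | fs fz     = fz , spine-adjˡ z<s (λ ()) , spine-adjˡ z<s (λ ())
... | fs (fs _) | fs (fs _) = fz , spine-adjˡ z<s (λ ()) , spine-adjˡ z<s (λ ())

lemma3p6 : (n : ℕ) → 3 ≤ n → Lambda≡ (book n) n
lemma3p6 n 3≤n = lambda≡order (book n) (book-commonNeighbour 3≤n)
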